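{- Let $k$ be a positive integer, let $S$ be a finite stream over $\mathcal{U}=[d]$, and let $S'$ be obtained from $S$ by removing one element. Let $(T,c)=\mathrm{MG}(k,S)$ and $(T',c')=\mathrm{MG}(k,S')$. Then $|T\cap T'|\ge k-2$, and all counters of keys in $(T\cup T')\setminus(T\cap T')$ have value at most $1$. Moreover, either (1) $c_i=c'_i-1$ for all $i\in T'$ and $c_j=0$ for all $j\notin T'$, or (2) there exists $i\in T$ such that $c_i=c'_i+1$ and $c_j=c'_j$ for all $j\ne i$.
   Context: Algorithm $\mathrm{MG}(k,S)$ (Misra–Gries variant): initialize the key set $T=\{d+1,\dots,d+k\}$ (dummy keys outside $\mathcal{U}$) with counters $c_i=0$ for $i\in T$. For each element $x$ of $S$ in order: (Branch 1) if $x\in T$, set $c_x\leftarrow c_x+1$; (Branch 2) else if $c_i\ge 1$ for all $i\in T$, set $c_i\leftarrow c_i-1$ for all $i\in T$; (Branch 3) otherwise let $y$ be the smallest key in $T$ with $c_y=0$, set $T\leftarrow (T\cup\{x\})\setminus\{y\}$ and $c_x\leftarrow 1$. Return $(T,c)$. Counters of keys not in the returned key set are implicitly $0$. -}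

module Defs where

open import Data.Nat using (ℕ; zero; suc; _+_; _∸_; _≤_; _<_; _⊓_; _≟_; _≤ᵇ_)
open import Data.Bool using (Bool; true; false; if_then_else_)
open import Data.List using (List; []; _∷_; filter; applyUpTo; foldl; length)
open import Data.List.Relation.Unary.All using (all?)
open import Relation.Nullary using (¬?; does)
open import Relation.Nullary.Decidable using (⌊_⌋)
open import Data.List.Membership.DecPropositional _≟_ using (_∈?_)

-- State of MG: the key set T (a duplicate-free list of keys) and a raw
-- counter array.
record State : Set where
  constructor st
  field
    keys : List ℕ
    cnt  : ℕ → ℕ
open State public

initState : ℕ → ℕ → State
initState d k = st (applyUpTo (λ i → d + suc i) k) (λ _ → 0)

minList : List ℕ → ℕ
minList []       = 0
minList (x ∷ xs) = foldl _⊓_ x xs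

update : (ℕ → ℕ) → ℕ → ℕ → (ℕ → ℕ)
update f x v j = if ⌊ j ≟ x ⌋ then v else f j

step : State → ℕ → State
step (st T c) x =
  if ⌊ x ∈? T ⌋
    then st T (update c x (suc (c x)))
    else (if ⌊ all? (λ i → 1 ≤? c i) T ⌋
      then st T (λ j → if ⌊ j ∈? T ⌋ then c j ∸ 1 else c j)
      else (let y = minList (filter (λ i → c i ≟ 0) T)
            in st (x ∷ filter (λ i → ¬? (i ≟ y)) T) (update c x 1)))
  where open import Data.Nat using (_≤?_)

run : State → List ℕ → State
run = foldl step

MG : ℕ → ℕ → List ℕ → State
MG d k S = run (initState d k) S

counter : State → ℕ → ℕ
counter s j = if ⌊ j ∈? keys s ⌋ then cnt s j else 0

interSize : List ℕ → List ℕ → ℕ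
interSize T T' = length (filter (λ i → i ∈? T') T)

{-# OPTIONS --safe #-}
-- Run MG on S and on S' in lockstep.  The two states coincide before the
-- removed element x; from x on they stay neighbouring: either x caused a
-- decrement, so every key of T' has counter one more than in T and T ∖ T' has
-- at most one element, or x raised a single counter i, so c = c' + δᵢ and
-- T ∖ T' has at most two elements.  Each later element preserves this, by a
-- case analysis on the branches the two runs take.  Most combinations are
-- ruled out, or the two key sets compared, by counting (both are
-- duplicate-free of size k, so |T ∖ T'| = |T' ∖ T|) and by the eviction rule:
-- as each run evicts its smallest key with counter 0, both evict the same key
-- whenever their counters agree on the candidates.
module Submission where

open import Defs
open import Data.Nat using (ℕ; suc; _+_; _∸_; _≤_; _<_; _⊓_; _≟_; z≤n; s≤s; _≤?_)
open import Data.Nat.Properties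
  using (module ≤-Reasoning; ≤-refl; ≤-reflexive; ≤-trans; ≤-antisym; <-irrefl; n≤1+n; m≤n⇒m≤1+n;
         ≰⇒>; n<1⇒n≡0; n>0⇒n≢0; ⊓-sel; m⊓n≤m; m⊓n≤n; m≤n+o⇒m∸n≤o; +-monoˡ-≤; +-cancelˡ-≡; suc-injective)
open import Data.List using (List; []; _∷_; _++_; [_]; filter; foldl; length)
open import Data.List.Properties using (filter-notAll; length-++; foldl-++; length-applyUpTo)
open import Data.List.Relation.Unary.All as All using (All; []; _∷_; all?)
open import Data.List.Relation.Unary.All.Properties using (¬Any⇒All¬; ¬All⇒Any¬)
open import Data.List.Relation.Unary.Any using (here; there; any?)
open import Data.List.Relation.Unary.Unique.Propositional using (Unique; _∷_)
import Data.List.Relation.Unary.Unique.Propositional.Properties as Unique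
open import Data.List.Relation.Binary.Subset.Propositional using (_⊆_)
open import Data.List.Membership.Propositional using (_∈_; _∉_; find; lose)
open import Data.List.Membership.Propositional.Properties using (∈-filter⁺; ∈-filter⁻; ∈-++⁺ˡ; ∈-++⁺ʳ)
open import Data.List.Membership.DecPropositional _≟_ using (_∈?_)
open import Data.Product using (_×_; Σ; ∃-syntax; _,_; proj₁; proj₂)
open import Data.Sum using (_⊎_; inj₁; inj₂; [_,_]′; map₁; map₂)
open import Data.Empty using (⊥-elim)
open import Data.Bool using (if_then_else_)
open import Function using (_∘_; id)
open import Relation.Nullary using (¬_; ¬?; yes; no; contradiction)
open import Relation.Nullary.Decidable using (⌊_⌋)
open import Relation.Binary.PropositionalEquality
  using (_≡_; _≢_; refl; sym; trans; cong; subst; subst₂; module ≡-Reasoning)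

private variable
  i j v w y z n : ℕ
  xs ys L T T' TA TB TA' TB' : List ℕ
  c c' cA cB cA' cB' : ℕ → ℕ

remove : ℕ → List ℕ → List ℕ
remove y = filter (λ j → ¬? (j ≟ y))

∈-remove⁺ : j ∈ xs → j ≢ y → j ∈ remove y xs
∈-remove⁺ = ∈-filter⁺ _

∈-remove⁻ : j ∈ remove y xs → j ∈ xs × j ≢ y
∈-remove⁻ {xs = xs} = ∈-filter⁻ _ {xs = xs}

∉-remove⇒≡ : j ∈ xs → j ∉ remove y xs → j ≡ y
∉-remove⇒≡ {j} {y = y} j∈ j∉ with j ≟ y
... | yes j≡y = j≡y
... | no  j≢y = contradiction (∈-remove⁺ j∈ j≢y) j∉

length-remove< : y ∈ xs → length (remove y xs) < length xs
length-remove< {xs = xs} y∈ = filter-notAll _ xs (lose y∈ λ y≢y → y≢y refl)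

Unique-⊆⇒length≤ : Unique xs → xs ⊆ ys → length xs ≤ length ys
Unique-⊆⇒length≤ {[]}     _          _   = z≤n
Unique-⊆⇒length≤ {x ∷ xs} (x∉ ∷ uxs) sub =
  ≤-trans (s≤s (Unique-⊆⇒length≤ uxs λ j∈ → ∈-remove⁺ (sub (there j∈)) λ j≡x → All.lookup x∉ j∈ (sym j≡x)))
          (length-remove< (sub (here refl)))

length-remove : Unique xs → y ∈ xs → suc (length (remove y xs)) ≡ length xs
length-remove {xs} {y} uxs y∈ = ≤-antisym (length-remove< y∈) (Unique-⊆⇒length≤ uxs y∷remove)
  where
  y∷remove : xs ⊆ y ∷ remove y xs
  y∷remove {j} j∈ with j ≟ y
  ... | yes j≡y = here j≡y
  ... | no  j≢y = there (∈-remove⁺ j∈ j≢y)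

Unique-∷-remove : z ∉ xs → Unique xs → Unique (z ∷ remove y xs)
Unique-∷-remove {z} {xs} {y} z∉ uxs =
  ¬Any⇒All¬ _ (z∉ ∘ proj₁ ∘ ∈-remove⁻ {xs = xs}) ∷ Unique.filter⁺ (λ j → ¬? (j ≟ y)) uxs

infix 4 _∖_⊆_

_∖_⊆_ : List ℕ → List ℕ → List ℕ → Set
xs ∖ ys ⊆ L = ∀ {j} → j ∈ xs → j ∉ ys → j ∈ L

length≤+interSize : Unique xs → xs ∖ ys ⊆ L → length xs ≤ length L + interSize xs ys
length≤+interSize {xs} {ys} {L} uxs diff =
  subst (length xs ≤_) (length-++ L) (Unique-⊆⇒length≤ uxs split)
  where
  split : xs ⊆ L ++ filter (_∈? ys) xs
  split {j} j∈ with j ∈? ys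
  ... | yes j∈ys = ∈-++⁺ʳ L (∈-filter⁺ (_∈? ys) j∈ j∈ys)
  ... | no  j∉ys = ∈-++⁺ˡ (diff j∈ j∉ys)

module _ (uxs : Unique xs) (uys : Unique ys) (|xs|≡|ys| : length xs ≡ length ys) where

  ∖-nonempty-sym : j ∈ xs → j ∉ ys → ∃[ b ] b ∈ ys × b ∉ xs
  ∖-nonempty-sym {j} j∈xs j∉ys with any? (λ b → ¬? (b ∈? xs)) ys
  ... | yes some = find some
  ... | no  none = ⊥-elim (<-irrefl refl ys<ys)
    where
    open ≤-Reasoning
    ys⊆ : ys ⊆ remove j xs
    ys⊆ {b} b∈ys with b ∈? xs
    ... | yes b∈xs = ∈-remove⁺ b∈xs λ { refl → j∉ys b∈ys }
    ... | no  b∉xs = contradiction (lose b∈ys b∉xs) none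
    ys<ys : length ys < length ys
    ys<ys = begin-strict
      length ys              ≤⟨ Unique-⊆⇒length≤ uys ys⊆ ⟩
      length (remove j xs)   <⟨ length-remove< j∈xs ⟩
      length xs              ≡⟨ |xs|≡|ys| ⟩
      length ys              ∎

  ∖-singleton-sym : xs ∖ ys ⊆ [ v ] → w ∈ ys → w ∉ xs → y ∈ ys → y ∉ xs → w ≡ y
  ∖-singleton-sym {v} {w} {y} diff w∈ys w∉xs y∈ys y∉xs with w ≟ y
  ... | yes w≡y = w≡y
  ... | no  w≢y = ⊥-elim (<-irrefl refl xs<xs)
    where
    open ≤-Reasoning
    xs⊆ : xs ⊆ v ∷ remove y (remove w ys)
    xs⊆ {a} a∈xs with a ∈? ys
    ... | yes a∈ys =
      there (∈-remove⁺ (∈-remove⁺ a∈ys λ { refl → w∉xs a∈xs }) λ { refl → y∉xs a∈xs })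
    ... | no  a∉ys with diff a∈xs a∉ys
    ...   | here a≡v = here a≡v
    xs<xs : length xs < length xs
    xs<xs = begin-strict
      length xs                              ≤⟨ Unique-⊆⇒length≤ uxs xs⊆ ⟩
      suc (length (remove y (remove w ys)))  <⟨ s≤s (length-remove< (∈-remove⁺ y∈ys (w≢y ∘ sym))) ⟩
      suc (length (remove w ys))             ≤⟨ length-remove< w∈ys ⟩
      length ys                              ≡⟨ sym |xs|≡|ys| ⟩
      length xs                              ∎

foldl-⊓-lowerBound : ∀ m xs → All (foldl _⊓_ m xs ≤_) (m ∷ xs)
foldl-⊓-lowerBound m []       = ≤-refl ∷ []
foldl-⊓-lowerBound m (x ∷ xs) with r≤m⊓x ∷ r≤xs ← foldl-⊓-lowerBound (m ⊓ x) xs =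
  ≤-trans r≤m⊓x (m⊓n≤m m x) ∷ ≤-trans r≤m⊓x (m⊓n≤n m x) ∷ r≤xs

foldl-⊓-∈ : ∀ m xs → foldl _⊓_ m xs ∈ m ∷ xs
foldl-⊓-∈ m []       = here refl
foldl-⊓-∈ m (x ∷ xs) with foldl-⊓-∈ (m ⊓ x) xs | ⊓-sel m x
... | there r∈xs | _           = there (there r∈xs)
... | here r≡m⊓x | inj₁ m⊓x≡m = here (trans r≡m⊓x m⊓x≡m)
... | here r≡m⊓x | inj₂ m⊓x≡x = there (here (trans r≡m⊓x m⊓x≡x))

minList-∈ : j ∈ xs → minList xs ∈ xs
minList-∈ {xs = m ∷ ms} _ = foldl-⊓-∈ m ms

minList-≤ : j ∈ xs → minList xs ≤ j
minList-≤ {xs = m ∷ ms} j∈ = All.lookup (foldl-⊓-lowerBound m ms) j∈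

IncrementedAt : ℕ → (ℕ → ℕ) → (ℕ → ℕ) → Set
IncrementedAt z c c' = c' z ≡ suc (c z) × (∀ j → j ≢ z → c' j ≡ c j)

IsMinZero : List ℕ → (ℕ → ℕ) → ℕ → Set
IsMinZero T c y = y ∈ T × c y ≡ 0 × (∀ {j} → j ∈ T → c j ≡ 0 → y ≤ j)

-- Branches 1 and 3 of MG both raise the counter of z by one and touch no
-- other counter, since the key evicted in branch 3 had counter 0.
data Bump (T : List ℕ) (c : ℕ → ℕ) (z : ℕ) : List ℕ → Set where
  hit   : z ∈ T → Bump T c z T
  evict : z ∉ T → IsMinZero T c y → Bump T c z (z ∷ remove y T)

data Step (T : List ℕ) (c : ℕ → ℕ) (z : ℕ) : List ℕ → (ℕ → ℕ) → Set where
  bump      : Bump T c z T' → IncrementedAt z c c' → Step T c z T' c'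
  decrement : z ∉ T → (∀ {j} → j ∈ T → 1 ≤ c j) → (∀ j → c' j ≡ c j ∸ 1) → Step T c z T c'

counter-∈ : ∀ c → j ∈ T → counter (st T c) j ≡ c j
counter-∈ {j} {T} c j∈ with j ∈? T
... | yes _   = refl
... | no  j∉ = contradiction j∈ j∉

counter-∉ : ∀ c → j ∉ T → counter (st T c) j ≡ 0
counter-∉ {j} {T} c j∉ with j ∈? T
... | yes j∈ = contradiction j∈ j∉
... | no  _  = refl

update-≡ : ∀ c z v → update c z v z ≡ v
update-≡ c z v with z ≟ z
... | yes _   = refl
... | no  z≢z = contradiction refl z≢z

update-≢ : ∀ c v → j ≢ z → update c z v j ≡ c j
update-≢ {j} {z} c v j≢z with j ≟ z
... | yes j≡z = contradiction j≡z j≢z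
... | no  _   = refl

counter-hit : z ∈ T → IncrementedAt z (counter (st T c)) (counter (st T (update c z (suc (c z)))))
counter-hit {z} {T} {c} z∈T = counter-z , counter-j
  where
  counter-z : counter (st T (update c z (suc (c z)))) z ≡ suc (counter (st T c) z)
  counter-z = trans (counter-∈ (update c z (suc (c z))) z∈T)
                    (trans (update-≡ c z _) (cong suc (sym (counter-∈ c z∈T))))
  counter-j : ∀ j → j ≢ z → counter (st T (update c z (suc (c z)))) j ≡ counter (st T c) j
  counter-j j j≢z with j ∈? T
  ... | yes _ = update-≢ c _ j≢z
  ... | no  _ = refl

counter-decrement : ∀ j → counter (st T (λ j → if ⌊ j ∈? T ⌋ then c j ∸ 1 else c j)) j
                        ≡ counter (st T c) j ∸ 1
counter-decrement {T} j with j ∈? T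
... | yes _ = refl
... | no  _ = refl

minList-isMinZero : ¬ All (λ j → 1 ≤ c j) T →
                    IsMinZero T (counter (st T c)) (minList (filter (λ j → c j ≟ 0) T))
minList-isMinZero {c} {T} ¬positive = y∈T , trans (counter-∈ c y∈T) cy≡0 , minimal
  where
  y∈zeros : minList (filter (λ j → c j ≟ 0) T) ∈ filter (λ j → c j ≟ 0) T
  y∈zeros with j , j∈T , cj≱1 ← find (¬All⇒Any¬ (λ j → 1 ≤? c j) T ¬positive) =
    minList-∈ (∈-filter⁺ _ j∈T (n<1⇒n≡0 (≰⇒> cj≱1)))
  y∈T : minList (filter (λ j → c j ≟ 0) T) ∈ T
  y∈T = proj₁ (∈-filter⁻ _ {xs = T} y∈zeros)
  cy≡0 : c (minList (filter (λ j → c j ≟ 0) T)) ≡ 0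
  cy≡0 = proj₂ (∈-filter⁻ _ {xs = T} y∈zeros)
  minimal : ∀ {j} → j ∈ T → counter (st T c) j ≡ 0 → minList (filter (λ j → c j ≟ 0) T) ≤ j
  minimal j∈T cj≡0 = minList-≤ (∈-filter⁺ _ j∈T (trans (sym (counter-∈ c j∈T)) cj≡0))

counter-evict : z ∉ T → IsMinZero T (counter (st T c)) y →
                IncrementedAt z (counter (st T c)) (counter (st (z ∷ remove y T) (update c z 1)))
counter-evict {z} {T} {c} {y} z∉T (_ , cy≡0 , _) = counter-z , counter-j
  where
  counter-z : counter (st (z ∷ remove y T) (update c z 1)) z ≡ suc (counter (st T c) z)
  counter-z = trans (counter-∈ (update c z 1) (here refl))
                    (trans (update-≡ c z 1) (cong suc (sym (counter-∉ c z∉T))))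
  counter-j : ∀ j → j ≢ z → counter (st (z ∷ remove y T) (update c z 1)) j ≡ counter (st T c) j
  counter-j j j≢z with j ≟ y
  ... | yes refl = trans (counter-∉ (update c z 1) j∉T⁺) (sym cy≡0)
    where
    j∉T⁺ : j ∉ z ∷ remove y T
    j∉T⁺ (here j≡z)  = j≢z j≡z
    j∉T⁺ (there j∈r) = proj₂ (∈-remove⁻ {xs = T} j∈r) refl
  ... | no j≢y with j ∈? T
  ...   | yes j∈T = trans (counter-∈ (update c z 1) (there (∈-remove⁺ j∈T j≢y))) (update-≢ c 1 j≢z)
  ...   | no  j∉T = counter-∉ (update c z 1) j∉T⁺
    where
    j∉T⁺ : j ∉ z ∷ remove y T
    j∉T⁺ (here j≡z)  = j≢z j≡z
    j∉T⁺ (there j∈r) = j∉T (proj₁ (∈-remove⁻ {xs = T} j∈r))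

step-view : ∀ s z → Step (keys s) (counter s) z (keys (step s z)) (counter (step s z))
step-view (st T c) z with z ∈? T
... | yes z∈T = bump (hit z∈T) (counter-hit z∈T)
... | no  z∉T with all? (λ j → 1 ≤? c j) T
...   | yes positive =
  decrement z∉T (λ j∈T → subst (1 ≤_) (sym (counter-∈ c j∈T)) (All.lookup positive j∈T))
    (counter-decrement {T = T} {c = c})
...   | no ¬positive = bump (evict z∉T y-min) (counter-evict z∉T y-min)
  where
  y-min : IsMinZero T (counter (st T c)) (minList (filter (λ j → c j ≟ 0) T))
  y-min = minList-isMinZero ¬positive

bump-∈ : Bump T c z T' → z ∈ T'
bump-∈ (hit z∈)    = z∈
bump-∈ (evict _ _) = here refl

bump-⊆ : Bump T c z T' → j ∈ T' → j ≢ z → j ∈ T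
bump-⊆ (hit _)                 j∈ _   = j∈
bump-⊆ (evict _ _)   (here j≡z)  j≢z = contradiction j≡z j≢z
bump-⊆ {T = T} (evict _ _) (there j∈) _ = proj₁ (∈-remove⁻ {xs = T} j∈)

bump-evicts-zero : Bump T c z T' → j ∈ T → j ∉ T' → c j ≡ 0
bump-evicts-zero (hit _)                    j∈ j∉ = contradiction j∈ j∉
bump-evicts-zero (evict _ (_ , cy≡0 , _)) j∈ j∉ with refl ← ∉-remove⇒≡ j∈ (j∉ ∘ there) = cy≡0

bump-keeps-positive : Bump T c z T' → j ∈ T → 1 ≤ c j → j ∈ T'
bump-keeps-positive {T' = T'} {j = j} b j∈ 1≤cj with j ∈? T'
... | yes j∈T' = j∈T'
... | no  j∉T' = contradiction (bump-evicts-zero b j∈ j∉T') (n>0⇒n≢0 1≤cj)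

record WellFormed (k : ℕ) (T : List ℕ) (c : ℕ → ℕ) : Set where
  field
    unique       : Unique T
    length≡      : length T ≡ k
    zero-outside : ∀ {j} → j ∉ T → c j ≡ 0
open WellFormed

suc[n∸1]≡n : 1 ≤ n → suc (n ∸ 1) ≡ n
suc[n∸1]≡n (s≤s _) = refl

wellFormed-step : ∀ {k} → WellFormed k T c → Step T c z T' c' → WellFormed k T' c'
wellFormed-step wf (decrement _ _ c'≡c∸1) = record
  { unique = unique wf ; length≡ = length≡ wf
  ; zero-outside = λ j∉ → trans (c'≡c∸1 _) (cong (_∸ 1) (zero-outside wf j∉)) }
wellFormed-step {T = T} {c = c} {z = z} {T' = T'} {c' = c'} {k} wf (bump b (_ , c'≡c)) = record
  { unique = unique′ b ; length≡ = length′ b ; zero-outside = zero-outside′ }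
  where
  unique′ : Bump T c z T' → Unique T'
  unique′ (hit _)       = unique wf
  unique′ (evict z∉ _)  = Unique-∷-remove z∉ (unique wf)
  length′ : Bump T c z T' → length T' ≡ k
  length′ (hit _)              = length≡ wf
  length′ (evict _ (y∈ , _)) = trans (length-remove (unique wf) y∈) (length≡ wf)
  zero-outside′ : ∀ {j} → j ∉ T' → c' j ≡ 0
  zero-outside′ {j} j∉T' = trans (c'≡c j j≢z) cj≡0
    where
    j≢z : j ≢ z
    j≢z refl = j∉T' (bump-∈ b)
    cj≡0 : c j ≡ 0
    cj≡0 with j ∈? T
    ... | yes j∈T = bump-evicts-zero b j∈T j∉T'
    ... | no  j∉T = zero-outside wf j∉T

OneLessOn : List ℕ → (ℕ → ℕ) → (ℕ → ℕ) → Set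
OneLessOn TB cA cB = (∀ j → j ∈ TB → cB j ≡ suc (cA j)) × (∀ j → j ∉ TB → cA j ≡ 0)

-- While cB i = 0 the run without the removed element may still evict i, which
-- the other run keeps; so i must already be counted in TA ∖ TB unless cB i ≥ 1.
data Slack (i : ℕ) (TA TB : List ℕ) (cB : ℕ → ℕ) : Set where
  slack : TA ∖ TB ⊆ L → length L ≤ 2 → i ∈ L ⊎ 1 ≤ cB i → Slack i TA TB cB

data Neighbouring (TA : List ℕ) (cA : ℕ → ℕ) (TB : List ℕ) (cB : ℕ → ℕ) : Set where
  decremented : OneLessOn TB cA cB → TA ∖ TB ⊆ L → length L ≤ 1 → Neighbouring TA cA TB cB
  incremented : i ∈ TA → IncrementedAt i cB cA → Slack i TA TB cB → Neighbouring TA cA TB cB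

incrementedAt-≤ : IncrementedAt z c c' → c j ≤ c' j
incrementedAt-≤ {z} {j = j} (c'z , c'j) with j ≟ z
... | yes refl = subst (_ ≤_) (sym c'z) (n≤1+n _)
... | no  j≢z  = ≤-reflexive (sym (c'j j j≢z))

incrementedAt-≤suc : IncrementedAt z c c' → c' j ≤ suc (c j)
incrementedAt-≤suc {z} {j = j} (c'z , c'j) with j ≟ z
... | yes refl = ≤-reflexive c'z
... | no  j≢z  = ≤-trans (≤-reflexive (c'j j j≢z)) (n≤1+n _)

incrementedAt-cong : (∀ j → c j ≡ cB j) → IncrementedAt z cB c' → IncrementedAt z c c'
incrementedAt-cong {z = z} c≡cB (c'z , c'j) =
  trans c'z (cong suc (sym (c≡cB z))) , λ j j≢z → trans (c'j j j≢z) (sym (c≡cB j))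

incrementedAt-both : IncrementedAt i cB cA → IncrementedAt z cA cA' → IncrementedAt z cB cB' →
                     IncrementedAt i cB' cA'
incrementedAt-both {i} {cB} {cA} {z} {cA'} {cB'} (cAi , cAj) (cA'z , cA'j) (cB'z , cB'j) = cA'i , cA'j′
  where
  cA'i : cA' i ≡ suc (cB' i)
  cA'i with i ≟ z
  ... | yes refl = trans cA'z (trans (cong suc cAi) (cong suc (sym cB'z)))
  ... | no  i≢z  = trans (cA'j i i≢z) (trans cAi (cong suc (sym (cB'j i i≢z))))
  cA'j′ : ∀ j → j ≢ i → cA' j ≡ cB' j
  cA'j′ j j≢i with j ≟ z
  ... | yes refl = trans cA'z (trans (cong suc (cAj j j≢i)) (sym cB'z))
  ... | no  j≢z  = trans (cA'j j j≢z) (trans (cAj j j≢i) (sym (cB'j j j≢z)))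

slack-swap : w ∈ L → length L ≤ 2 → (∀ {j} → j ∈ TA' → j ∉ TB' → (j ∈ L × j ≢ w) ⊎ j ≡ v) →
             (i ∈ L × i ≢ w) ⊎ 1 ≤ cB' i → Slack i TA' TB' cB'
slack-swap {w = w} {L = L} {TA' = TA'} {TB' = TB'} {v = v} w∈L |L|≤2 diff cond =
  slack diff′ (≤-trans (length-remove< w∈L) |L|≤2)
        (map₁ (λ (i∈L , i≢w) → there (∈-remove⁺ i∈L i≢w)) cond)
  where
  diff′ : TA' ∖ TB' ⊆ v ∷ remove w L
  diff′ j∈ j∉ with diff j∈ j∉
  ... | inj₁ (j∈L , j≢w) = there (∈-remove⁺ j∈L j≢w)
  ... | inj₂ j≡v         = here j≡v

bump-∖-hit : Bump TA cA z TA' → z ∈ TB → TA ∖ TB ⊆ L → TA' ∖ TB ⊆ L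
bump-∖-hit b z∈TB diff j∈ j∉ = diff (bump-⊆ b j∈ λ { refl → j∉ z∈TB }) j∉

∈-∖-evict⁻ : Bump TA cA z TA' → j ∈ TA' → j ∉ z ∷ remove y TB → j ∈ TA × (j ∉ TB ⊎ j ≡ y)
∈-∖-evict⁻ {j = j} {y = y} {TB = TB} bA j∈TA' j∉TB' =
  bump-⊆ bA j∈TA' (j∉TB' ∘ here) , outside-or-evicted
  where
  outside-or-evicted : j ∉ TB ⊎ j ≡ y
  outside-or-evicted with j ∈? TB
  ... | yes j∈TB = inj₂ (∉-remove⇒≡ j∈TB (j∉TB' ∘ there))
  ... | no  j∉TB = inj₁ j∉TB

∖-evict-⊆ : Bump TA cA z TA' → TA ∖ TB ⊆ L → (y ∈ TA' → y ∈ L) → TA' ∖ (z ∷ remove y TB) ⊆ L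
∖-evict-⊆ bA diff y∈L j∈TA' j∉TB' with ∈-∖-evict⁻ bA j∈TA' j∉TB'
... | j∈TA , inj₁ j∉TB = diff j∈TA j∉TB
... | _    , inj₂ refl = y∈L j∈TA'

incrementedAt-decrement : IncrementedAt i cB cA → 1 ≤ cB i →
                          (∀ j → cA' j ≡ cA j ∸ 1) → (∀ j → cB' j ≡ cB j ∸ 1) → IncrementedAt i cB' cA'
incrementedAt-decrement {i} {cB} {cA} {cA'} {cB'} (cAi , cAj) 1≤cBi decA decB = cA'i , cA'j
  where
  open ≡-Reasoning
  cA'i : cA' i ≡ suc (cB' i)
  cA'i = begin
    cA' i            ≡⟨ decA i ⟩
    cA i ∸ 1         ≡⟨ cong (_∸ 1) cAi ⟩
    cB i             ≡⟨ sym (suc[n∸1]≡n 1≤cBi) ⟩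
    suc (cB i ∸ 1)   ≡⟨ cong suc (sym (decB i)) ⟩
    suc (cB' i)      ∎
  cA'j : ∀ j → j ≢ i → cA' j ≡ cB' j
  cA'j j j≢i = trans (decA j) (trans (cong (_∸ 1) (cAj j j≢i)) (sym (decB j)))

oneLessOn-bump : z ∈ TB → OneLessOn TB cA cB → IncrementedAt z cA cA' → IncrementedAt z cB cB' →
                 OneLessOn TB cA' cB'
oneLessOn-bump {z} {TB} {cA} {cB} {cA'} {cB'} z∈TB (cB-on , cA-off) (cA'z , cA'j) (cB'z , cB'j) = cB'-on , cA'-off
  where
  cB'-on : ∀ j → j ∈ TB → cB' j ≡ suc (cA' j)
  cB'-on j j∈ with j ≟ z
  ... | yes refl = trans cB'z (cong suc (trans (cB-on j j∈) (sym cA'z)))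
  ... | no  j≢z  = trans (cB'j j j≢z) (trans (cB-on j j∈) (cong suc (sym (cA'j j j≢z))))
  cA'-off : ∀ j → j ∉ TB → cA' j ≡ 0
  cA'-off j j∉ = trans (cA'j j λ { refl → j∉ z∈TB }) (cA-off j j∉)

module Decremented {k} (wA : WellFormed k TA cA) (wB : WellFormed k TB cB)
                   (rel : OneLessOn TB cA cB) where

  private
    cB-on : ∀ j → j ∈ TB → cB j ≡ suc (cA j)
    cB-on = proj₁ rel
    cA-off : ∀ j → j ∉ TB → cA j ≡ 0
    cA-off = proj₂ rel

  |TB|≡|TA| : length TB ≡ length TA
  |TB|≡|TA| = trans (length≡ wB) (sym (length≡ wA))

  positive-on-TB : j ∈ TB → 1 ≤ cB j
  positive-on-TB j∈TB = subst (1 ≤_) (sym (cB-on _ j∈TB)) (s≤s z≤n)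

  ⊇-if-positive : (∀ {j} → j ∈ TA → 1 ≤ cA j) → TB ⊆ TA
  ⊇-if-positive positive {b} b∈TB with b ∈? TA
  ... | yes b∈TA = b∈TA
  ... | no  b∉TA with a , a∈TA , a∉TB ← ∖-nonempty-sym (unique wB) (unique wA) |TB|≡|TA| b∈TB b∉TA =
    contradiction (cA-off a a∉TB) (n>0⇒n≢0 (positive a∈TA))

  cB-decrement : (∀ j → cB' j ≡ cB j ∸ 1) → ∀ j → cB' j ≡ cA j
  cB-decrement decB j with j ∈? TB
  ... | yes j∈TB = trans (decB j) (cong (_∸ 1) (cB-on j j∈TB))
  ... | no  j∉TB = trans (decB j) (trans (cong (_∸ 1) (zero-outside wB j∉TB)) (sym (cA-off j j∉TB)))

  decremented-step : TA ∖ TB ⊆ L → length L ≤ 1 →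
                     Step TA cA z TA' cA' → Step TB cB z TB' cB' → Neighbouring TA' cA' TB' cB'
  decremented-step diff |L|≤1 (bump bA incA) (bump (hit z∈TB) incB) =
    decremented (oneLessOn-bump z∈TB rel incA incB) (bump-∖-hit bA z∈TB diff) |L|≤1
  decremented-step _ _ _ (bump (evict _ (y∈TB , cBy≡0 , _)) _) =
    contradiction cBy≡0 (n>0⇒n≢0 (positive-on-TB y∈TB))
  decremented-step {L = L} {z = z} {TA' = TA'} diff |L|≤1 (bump bA incA) (decrement _ _ decB) =
    incremented (bump-∈ bA) (incrementedAt-cong (cB-decrement decB) incA)
                (slack {L = z ∷ L} diff′ (s≤s |L|≤1) (inj₁ (here refl)))
    where
    diff′ : TA' ∖ TB ⊆ z ∷ L
    diff′ {j} j∈ j∉ with j ≟ z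
    ... | yes j≡z = here j≡z
    ... | no  j≢z = there (diff (bump-⊆ bA j∈ j≢z) j∉)
  decremented-step _ _ (decrement z∉TA positive _) (bump (hit z∈TB) _) =
    contradiction (⊇-if-positive positive z∈TB) z∉TA
  decremented-step {cA' = cA'} {cB' = cB'} diff |L|≤1 (decrement _ positive decA) (decrement _ _ decB) =
    decremented (cB'-on , cA'-off) diff |L|≤1
    where
    cB'-on : ∀ j → j ∈ TB → cB' j ≡ suc (cA' j)
    cB'-on j j∈TB = begin
      cB' j            ≡⟨ cB-decrement decB j ⟩
      cA j             ≡⟨ sym (suc[n∸1]≡n (positive (⊇-if-positive positive j∈TB))) ⟩
      suc (cA j ∸ 1)   ≡⟨ cong suc (sym (decA j)) ⟩
      suc (cA' j)      ∎
      where open ≡-Reasoning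
    cA'-off : ∀ j → j ∉ TB → cA' j ≡ 0
    cA'-off j j∉TB = trans (decA j) (cong (_∸ 1) (cA-off j j∉TB))

module Incremented {k} (wA : WellFormed k TA cA) (wB : WellFormed k TB cB)
                   (i∈TA : i ∈ TA) (inc : IncrementedAt i cB cA) where

  |TA|≡|TB| : length TA ≡ length TB
  |TA|≡|TB| = trans (length≡ wA) (sym (length≡ wB))

  cB≡cA : j ≢ i → cB j ≡ cA j
  cB≡cA j≢i = sym (proj₂ inc _ j≢i)

  zero⇒≢i : cA j ≡ 0 → j ≢ i
  zero⇒≢i cAj≡0 refl = n>0⇒n≢0 (subst (1 ≤_) (sym (proj₁ inc)) (s≤s z≤n)) cAj≡0

  zero-on-TB∖TA : j ∈ TB → j ∉ TA → cB j ≡ 0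
  zero-on-TB∖TA j∈TB j∉TA = trans (cB≡cA λ { refl → j∉TA i∈TA }) (zero-outside wA j∉TA)

  ⊆-if-positive : (∀ {j} → j ∈ TB → 1 ≤ cB j) → TA ⊆ TB
  ⊆-if-positive positive {a} a∈TA with a ∈? TB
  ... | yes a∈TB = a∈TB
  ... | no  a∉TB with b , b∈TB , b∉TA ← ∖-nonempty-sym (unique wA) (unique wB) |TA|≡|TB| a∈TA a∉TB =
    contradiction (zero-on-TB∖TA b∈TB b∉TA) (n>0⇒n≢0 (positive b∈TB))

  private
    raise : IncrementedAt z cB cB' → i ∈ L ⊎ 1 ≤ cB i → i ∈ L ⊎ 1 ≤ cB' i
    raise incB = map₂ λ 1≤cBi → ≤-trans 1≤cBi (incrementedAt-≤ incB)

  -- The key y evicted by B stays in A and joins TA ∖ TB.  In exchange z (when A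
  -- hits it) or the key evicted by A leaves TA ∖ TB; by minimality the latter
  -- is y itself when it lies in TB.
  slack-evict-shared : Slack i TA TB cB → Bump TA cA z TA' → z ∉ TB → IsMinZero TB cB y →
                       IncrementedAt z cB cB' → y ∈ TA → y ≢ i → Slack i TA' (z ∷ remove y TB) cB'
  slack-evict-shared {z = z} {TA' = TA'} {y = y} {cB' = cB'}
                     (slack {L = L} diff |L|≤2 cond) bA z∉TB (y∈TB , cBy≡0 , minB) incB y∈TA y≢i = go bA
    where
    cond⁺ : i ≢ w → (i ∈ L × i ≢ w) ⊎ 1 ≤ cB' i
    cond⁺ i≢w = map₁ (_, i≢w) (raise incB cond)
    go : Bump TA cA z TA' → Slack i TA' (z ∷ remove y TB) cB'
    go (hit z∈TA) = slack-swap (diff z∈TA z∉TB) |L|≤2 diff′ cond′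
      where
      diff′ : ∀ {j} → j ∈ TA' → j ∉ z ∷ remove y TB → (j ∈ L × j ≢ z) ⊎ j ≡ y
      diff′ j∈ j∉ with ∈-∖-evict⁻ bA j∈ j∉
      ... | j∈TA , inj₁ j∉TB = inj₁ (diff j∈TA j∉TB , j∉ ∘ here)
      ... | _    , inj₂ j≡y  = inj₂ j≡y
      cond′ : (i ∈ L × i ≢ z) ⊎ 1 ≤ cB' i
      cond′ with i ≟ z
      ... | yes refl = inj₂ (subst (1 ≤_) (sym (proj₁ incB)) (s≤s z≤n))
      ... | no  i≢z  = cond⁺ i≢z
    go (evict {y = yA} _ (yA∈TA , cAyA≡0 , minA)) with yA ∈? TB
    ... | yes yA∈TB = slack (∖-evict-⊆ bA diff y∈TA'⇒y∈L) |L|≤2 (raise incB cond)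
      where
      yA≡y : yA ≡ y
      yA≡y = ≤-antisym (minA y∈TA (trans (sym (cB≡cA y≢i)) cBy≡0))
                       (minB yA∈TB (trans (cB≡cA (zero⇒≢i cAyA≡0)) cAyA≡0))
      y∈TA'⇒y∈L : y ∈ TA' → y ∈ L
      y∈TA'⇒y∈L (here y≡z)  = contradiction (subst (_∈ TB) y≡z y∈TB) z∉TB
      y∈TA'⇒y∈L (there y∈r) = contradiction (sym yA≡y) (proj₂ (∈-remove⁻ {xs = TA} y∈r))
    ... | no  yA∉TB = slack-swap (diff yA∈TA yA∉TB) |L|≤2 diff′ (cond⁺ (zero⇒≢i cAyA≡0 ∘ sym))
      where
      diff′ : ∀ {j} → j ∈ TA' → j ∉ z ∷ remove y TB → (j ∈ L × j ≢ yA) ⊎ j ≡ y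
      diff′ j∈ j∉ with ∈-∖-evict⁻ bA j∈ j∉ | j∈
      ... | _    , inj₂ j≡y  | _          = inj₂ j≡y
      ... | _    , inj₁ _    | here j≡z   = contradiction (here j≡z) j∉
      ... | j∈TA , inj₁ j∉TB | there j∈r = inj₁ (diff j∈TA j∉TB , proj₂ (∈-remove⁻ {xs = TA} j∈r))

  slack-bump : Slack i TA TB cB → Bump TA cA z TA' → Bump TB cB z TB' → IncrementedAt z cB cB' →
               Slack i TA' TB' cB'
  slack-bump (slack diff |L|≤2 cond) bA (hit z∈TB) incB =
    slack (bump-∖-hit bA z∈TB diff) |L|≤2 (raise incB cond)
  slack-bump σ@(slack {L = L} diff |L|≤2 cond) bA (evict {y = y} z∉TB y-min@(y∈TB , cBy≡0 , _)) incB
    with y ∈? TA | y ≟ i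
  ... | yes y∈TA | no y≢i   = slack-evict-shared σ bA z∉TB y-min incB y∈TA y≢i
  ... | yes _    | yes refl = slack (∖-evict-⊆ bA diff λ _ → i∈L) |L|≤2 (inj₁ i∈L)
    where
    i∈L : i ∈ L
    i∈L = [ id , (λ 1≤cBi → contradiction cBy≡0 (n>0⇒n≢0 1≤cBi)) ]′ cond
  ... | no  y∉TA | _        =
    slack (∖-evict-⊆ bA diff y∉TA') |L|≤2 (raise incB cond)
    where
    y∉TA' : y ∈ _ → y ∈ L
    y∉TA' y∈TA' = contradiction (bump-⊆ bA y∈TA' λ { refl → z∉TB y∈TB }) y∉TA

  decrement-bump : WellFormed k TB' cB' → z ∉ TA → (∀ {j} → j ∈ TA → 1 ≤ cA j) → (∀ j → cA' j ≡ cA j ∸ 1) →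
                   Bump TB cB z TB' → IncrementedAt z cB cB' → Neighbouring TA cA' TB' cB'
  decrement-bump {TB' = TB'} {cB' = cB'} {z = z} {cA' = cA'} wB' z∉TA positive decA bB incB =
    decremented (cB'-one-more , cA'-zero) TA∖TB'⊆[i] ≤-refl
    where
    |TA|≡|TB'| : length TA ≡ length TB'
    |TA|≡|TB'| = trans (length≡ wA) (sym (length≡ wB'))
    cB-zero : j ∉ TB' → cB j ≡ 0
    cB-zero {j} j∉ = trans (sym (proj₂ incB j λ { refl → j∉ (bump-∈ bB) })) (zero-outside wB' j∉)
    TA∖TB'⊆[i] : TA ∖ TB' ⊆ [ i ]
    TA∖TB'⊆[i] {a} a∈TA a∉TB' with a ≟ i
    ... | yes a≡i = here a≡i
    ... | no  a≢i = contradiction (trans (proj₂ inc a a≢i) (cB-zero a∉TB')) (n>0⇒n≢0 (positive a∈TA))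
    i∉TB' : i ∉ TB'
    i∉TB' i∈TB' with ∖-nonempty-sym (unique wB') (unique wA) (sym |TA|≡|TB'|) (bump-∈ bB) z∉TA
    ... | b , b∈TA , b∉TB' with TA∖TB'⊆[i] b∈TA b∉TB'
    ...   | here refl = b∉TB' i∈TB'
    cA'-zero : ∀ j → j ∉ TB' → cA' j ≡ 0
    cA'-zero j j∉ with j ≟ i
    ... | yes refl = trans (decA j) (cong (_∸ 1) (trans (proj₁ inc) (cong suc (cB-zero j∉))))
    ... | no  j≢i  = trans (decA j) (cong (_∸ 1) (trans (proj₂ inc j j≢i) (cB-zero j∉)))
    cB'-one-more : ∀ j → j ∈ TB' → cB' j ≡ suc (cA' j)
    cB'-one-more j j∈ with j ∈? TA
    ... | no j∉TA
      with refl ← ∖-singleton-sym (unique wA) (unique wB') |TA|≡|TB'| TA∖TB'⊆[i] j∈ j∉TA (bump-∈ bB) z∉TA =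
      trans (proj₁ incB) (cong suc (trans cBz≡0 (sym (trans (decA j) (cong (_∸ 1) cAz≡0)))))
      where
      cAz≡0 : cA j ≡ 0
      cAz≡0 = zero-outside wA j∉TA
      cBz≡0 : cB j ≡ 0
      cBz≡0 = trans (cB≡cA λ { refl → j∉TA i∈TA }) cAz≡0
    ... | yes j∈TA = begin
      cB' j            ≡⟨ proj₂ incB j (λ { refl → z∉TA j∈TA }) ⟩
      cB j             ≡⟨ cB≡cA (λ { refl → i∉TB' j∈ }) ⟩
      cA j             ≡⟨ sym (suc[n∸1]≡n (positive j∈TA)) ⟩
      suc (cA j ∸ 1)   ≡⟨ cong suc (sym (decA j)) ⟩
      suc (cA' j)      ∎
      where open ≡-Reasoning

  incremented-step : WellFormed k TB' cB' → Slack i TA TB cB →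
                     Step TA cA z TA' cA' → Step TB cB z TB' cB' → Neighbouring TA' cA' TB' cB'
  incremented-step _ σ (bump bA incA) (bump bB incB) =
    incremented (bump-keeps-positive bA i∈TA (subst (1 ≤_) (sym (proj₁ inc)) (s≤s z≤n)))
                (incrementedAt-both inc incA incB) (slack-bump σ bA bB incB)
  incremented-step _ _ (bump (hit z∈TA) _) (decrement z∉TB positive _) =
    contradiction (⊆-if-positive positive z∈TA) z∉TB
  incremented-step _ _ (bump (evict _ (y∈TA , cAy≡0 , _)) _) (decrement _ positive _) =
    contradiction (trans (cB≡cA (zero⇒≢i cAy≡0)) cAy≡0)
                  (n>0⇒n≢0 (positive (⊆-if-positive positive y∈TA)))
  incremented-step _ _ (decrement _ _ decA) (decrement _ positive decB) =
    incremented i∈TA (incrementedAt-decrement inc (positive (TA⊆TB i∈TA)) decA decB)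
                (slack {L = [ i ]} (λ j∈ j∉ → contradiction (TA⊆TB j∈) j∉) (s≤s z≤n) (inj₁ (here refl)))
    where
    TA⊆TB : TA ⊆ TB
    TA⊆TB = ⊆-if-positive positive
  incremented-step wB' _ (decrement z∉TA positive decA) (bump bB incB) =
    decrement-bump wB' z∉TA positive decA bB incB

neighbouring-start : WellFormed n T c → Step T c z T' c' → Neighbouring T' c' T c
neighbouring-start {T = T} {z = z} {T' = T'} _ (bump b inc) =
  incremented (bump-∈ b) inc (slack {L = [ z ]} only-z (s≤s z≤n) (inj₁ (here refl)))
  where
  only-z : T' ∖ T ⊆ [ z ]
  only-z {j} j∈ j∉ with j ≟ z
  ... | yes j≡z = here j≡z
  ... | no  j≢z = contradiction (bump-⊆ b j∈ j≢z) j∉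
neighbouring-start {T = T} {c = c} {c' = c'} wf (decrement _ positive dec) =
  decremented {L = []} (c-on , c'-off) (λ j∈ j∉ → contradiction j∈ j∉) z≤n
  where
  c-on : ∀ j → j ∈ T → c j ≡ suc (c' j)
  c-on j j∈ = trans (sym (suc[n∸1]≡n (positive j∈))) (cong suc (sym (dec j)))
  c'-off : ∀ j → j ∉ T → c' j ≡ 0
  c'-off j j∉ = trans (dec j) (cong (_∸ 1) (zero-outside wf j∉))

neighbouring-step : WellFormed n TA cA → WellFormed n TB cB → WellFormed n TB' cB' →
                    Neighbouring TA cA TB cB → Step TA cA z TA' cA' → Step TB cB z TB' cB' →
                    Neighbouring TA' cA' TB' cB'
neighbouring-step wA wB _   (decremented rel diff |L|≤1) = Decremented.decremented-step wA wB rel diff |L|≤1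
neighbouring-step wA wB wB' (incremented i∈TA inc σ)     = Incremented.incremented-step wA wB i∈TA inc wB' σ

WellFormedState : ℕ → State → Set
WellFormedState n s = WellFormed n (keys s) (counter s)

NeighbouringStates : State → State → Set
NeighbouringStates A B = Neighbouring (keys A) (counter A) (keys B) (counter B)

wellFormed-init : ∀ d k → WellFormedState k (initState d k)
wellFormed-init d k = record
  { unique       = Unique.applyUpTo⁺₁ (λ i → d + suc i) k
                     (λ i<j _ d+i≡d+j → <-irrefl (suc-injective (+-cancelˡ-≡ d _ _ d+i≡d+j)) i<j)
  ; length≡      = length-applyUpTo _ k
  ; zero-outside = counter-∉ _ }

wellFormed-run : ∀ s ys → WellFormedState n s → WellFormedState n (run s ys)
wellFormed-run s []       w = w
wellFormed-run s (y ∷ ys) w = wellFormed-run (step s y) ys (wellFormed-step w (step-view s y))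

neighbouring-run : ∀ A B ys → WellFormedState n A → WellFormedState n B →
                   NeighbouringStates A B → NeighbouringStates (run A ys) (run B ys)
neighbouring-run A B []       _  _  nb = nb
neighbouring-run A B (y ∷ ys) wA wB nb =
  neighbouring-run (step A y) (step B y) ys (wellFormed-step wA (step-view A y)) wB'
    (neighbouring-step wA wB wB' nb (step-view A y) (step-view B y))
  where
  wB' : WellFormedState _ (step B y)
  wB' = wellFormed-step wB (step-view B y)

∸≤interSize : Unique TA → length TA ≡ n → TA ∖ TB ⊆ L → length L ≤ w → n ∸ w ≤ interSize TA TB
∸≤interSize {TA = TA} {TB = TB} {L = L} {w = w} uTA refl diff |L|≤w =
  m≤n+o⇒m∸n≤o (length TA) w (≤-trans (length≤+interSize uTA diff) (+-monoˡ-≤ (interSize TA TB) |L|≤w))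

neighbouring-close : WellFormed n TB cB → Neighbouring TA cA TB cB →
                     ∀ j → cA j ≤ suc (cB j) × cB j ≤ suc (cA j)
neighbouring-close {TB = TB} wB (decremented (cB-on , cA-off) _ _) j with j ∈? TB
... | yes j∈TB = ≤-trans (n≤1+n _) (≤-trans (≤-reflexive (sym (cB-on j j∈TB))) (n≤1+n _))
               , ≤-reflexive (cB-on j j∈TB)
... | no  j∉TB = ≤-trans (≤-reflexive (cA-off j j∉TB)) z≤n
               , ≤-trans (≤-reflexive (zero-outside wB j∉TB)) z≤n
neighbouring-close _ (incremented _ inc _) j = incrementedAt-≤suc inc , ≤-trans (incrementedAt-≤ inc) (n≤1+n _)

symmetric-difference-≤1 : WellFormed n TA cA → WellFormed n TB cB →
                          (∀ j → cA j ≤ suc (cB j) × cB j ≤ suc (cA j)) →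
                          ∀ j → (j ∈ TA × j ∉ TB) ⊎ (j ∉ TA × j ∈ TB) → cA j ≤ 1 × cB j ≤ 1
symmetric-difference-≤1 _ wB close j (inj₁ (_ , j∉TB)) =
  subst (λ v → _ ≤ suc v) (zero-outside wB j∉TB) (proj₁ (close j))
  , ≤-trans (≤-reflexive (zero-outside wB j∉TB)) z≤n
symmetric-difference-≤1 wA _ close j (inj₂ (j∉TA , _)) =
  ≤-trans (≤-reflexive (zero-outside wA j∉TA)) z≤n
  , subst (λ v → _ ≤ suc v) (zero-outside wA j∉TA) (proj₂ (close j))

Conclusion : ℕ → List ℕ → (ℕ → ℕ) → List ℕ → (ℕ → ℕ) → Set
Conclusion k TA cA TB cB =
  (k ∸ 2 ≤ interSize TA TB)
  × (∀ j → (j ∈ TA × j ∉ TB) ⊎ (j ∉ TA × j ∈ TB) → cA j ≤ 1 × cB j ≤ 1)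
  × (OneLessOn TB cA cB ⊎ Σ ℕ (λ i → i ∈ TA × IncrementedAt i cB cA))

neighbouring⇒conclusion : WellFormed n TA cA → WellFormed n TB cB → Neighbouring TA cA TB cB →
                          Conclusion n TA cA TB cB
neighbouring⇒conclusion {n} {TA} {cA} {TB} {cB} wA wB nb =
  intersection nb , symmetric-difference-≤1 wA wB (neighbouring-close wB nb) , shape nb
  where
  intersection : Neighbouring TA cA TB cB → n ∸ 2 ≤ interSize TA TB
  intersection (decremented _ diff |L|≤1)        = ∸≤interSize (unique wA) (length≡ wA) diff (m≤n⇒m≤1+n |L|≤1)
  intersection (incremented _ _ (slack diff |L|≤2 _)) = ∸≤interSize (unique wA) (length≡ wA) diff |L|≤2
  shape : Neighbouring TA cA TB cB → OneLessOn TB cA cB ⊎ Σ ℕ (λ i → i ∈ TA × IncrementedAt i cB cA)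
  shape (decremented rel _ _)  = inj₁ rel
  shape (incremented i∈ inc _) = inj₂ (_ , i∈ , inc)

lemma5p2 : (d k : ℕ) → 0 < k → (xs : List ℕ) (x : ℕ) (ys : List ℕ) →
    All (λ e → 1 ≤ e × e ≤ d) (xs ++ x ∷ ys) →
    let T  = keys (MG d k (xs ++ x ∷ ys))
        c  = counter (MG d k (xs ++ x ∷ ys))
        T' = keys (MG d k (xs ++ ys))
        c' = counter (MG d k (xs ++ ys))
    in (k ∸ 2 ≤ interSize T T')
       × (∀ i → ((i ∈ T × i ∉ T') ⊎ (i ∉ T × i ∈ T')) → c i ≤ 1 × c' i ≤ 1)
       × (((∀ i → i ∈ T' → c' i ≡ suc (c i)) × (∀ j → j ∉ T' → c j ≡ 0))
          ⊎ Σ ℕ (λ i → i ∈ T × c i ≡ suc (c' i) × (∀ j → j ≢ i → c j ≡ c' j)))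
lemma5p2 d k _ xs x ys _ =
  subst₂ (λ A B → Conclusion k (keys A) (counter A) (keys B) (counter B))
    (sym (foldl-++ step (initState d k) xs (x ∷ ys))) (sym (foldl-++ step (initState d k) xs ys))
    (neighbouring⇒conclusion (wellFormed-run (step s x) ys ws⁺) (wellFormed-run s ys ws)
      (neighbouring-run (step s x) s ys ws⁺ ws (neighbouring-start ws (step-view s x))))
  where
  s : State
  s = run (initState d k) xs
  ws : WellFormedState k s
  ws = wellFormed-run (initState d k) xs (wellFormed-init d k)
  ws⁺ : WellFormedState k (step s x)
  ws⁺ = wellFormed-step ws (step-view s x)
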